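{- Let $G$ be a finite simple graph in which every vertex is either a leaf or a stem. Then $G\in\Omega$.
   Context: A leaf is a vertex of degree one; a stem is a vertex having at least one leaf as a neighbor. A star is a graph isomorphic to $K_{1,n}$ for some $n\ge 1$. A star-factor of $G$ is a spanning subgraph each of whose connected components is a star. An edge-weighting of $G$ is a function $w:E(G)\to\mathbb{N}^+$ (positive integers), and the weight of a subgraph $H$ is $w(H)=\sum_{e\in E(H)}w(e)$. $\Omega$ denotes the family of all graphs $G$ for which there exists an edge-weighting $w$ of $G$ such that all star-factors of $G$ have the same weight under $w$. -}

module Defs where

open import Data.Nat using (ℕ; zero; suc; _+_; _≤_; _<ᵇ_)
open import Data.Fin using (Fin; toℕ)
import Data.Fin as F
open import Data.Bool using (Bool; true; false; if_then_else_; _∧_)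
open import Data.Product using (Σ; ∃; _×_; _,_)
open import Data.Sum using (_⊎_)
open import Relation.Binary.PropositionalEquality using (_≡_; _≢_)

sumFin : (n : ℕ) → (Fin n → ℕ) → ℕ
sumFin zero    f = 0
sumFin (suc n) f = f F.zero + sumFin n (λ i → f (F.suc i))

record Graph (n : ℕ) : Set where
  field
    adj   : Fin n → Fin n → Bool
    sym   : ∀ i j → adj i j ≡ adj j i
    irrefl : ∀ i → adj i i ≡ false
open Graph public

degree : {n : ℕ} → Graph n → Fin n → ℕ
degree {n} G i = sumFin n (λ j → if adj G i j then 1 else 0)

IsLeaf : {n : ℕ} → Graph n → Fin n → Set
IsLeaf G v = degree G v ≡ 1

IsStem : {n : ℕ} → Graph n → Fin n → Set
IsStem G v = ∃ λ u → adj G v u ≡ true × IsLeaf G u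

record SpanningSubgraph {n : ℕ} (G : Graph n) (H : Fin n → Fin n → Bool) : Set where
  field
    sub  : ∀ i j → H i j ≡ true → adj G i j ≡ true
    symH : ∀ i j → H i j ≡ H j i

data Reach {n : ℕ} (H : Fin n → Fin n → Bool) : Fin n → Fin n → Set where
  here : ∀ {v} → Reach H v v
  step : ∀ {u v w} → Reach H u v → H v w ≡ true → Reach H u w

-- The connected component of v in H is a star K_{1,m} with m ≥ 1:
-- there is a centre c in the component, having at least one neighbour,
-- every other vertex of the component is adjacent to c, and every edge
-- of the component is incident with c.
ComponentIsStar : {n : ℕ} → (Fin n → Fin n → Bool) → Fin n → Set
ComponentIsStar {n} H v =
  Σ (Fin n) λ c →
    Reach H v c
    × (∃ λ x → H c x ≡ true)
    × (∀ x → Reach H v x → x ≢ c → H c x ≡ true)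
    × (∀ x y → Reach H v x → H x y ≡ true → (x ≡ c ⊎ y ≡ c))

IsStarFactor : {n : ℕ} → Graph n → (Fin n → Fin n → Bool) → Set
IsStarFactor G H = SpanningSubgraph G H × (∀ v → ComponentIsStar H v)

-- Weight of the subgraph with edge set H under w: each edge {i,j} counted
-- once, via the ordered pair i < j.
weight : {n : ℕ} → (Fin n → Fin n → ℕ) → (Fin n → Fin n → Bool) → ℕ
weight {n} w H =
  sumFin n (λ i → sumFin n (λ j →
    if (toℕ i <ᵇ toℕ j) ∧ H i j then w i j else 0))

-- An edge-weighting with positive integer values: only the values on
-- edges matter (the weight only reads w on edges), and these must be ≥ 1.
IsEdgeWeighting : {n : ℕ} → Graph n → (Fin n → Fin n → ℕ) → Set
IsEdgeWeighting {n} G w = ∀ i j → adj G i j ≡ true → 1 ≤ w i j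

InΩ : {n : ℕ} → Graph n → Set
InΩ {n} G =
  Σ (Fin n → Fin n → ℕ) λ w →
    IsEdgeWeighting G w
    × (∀ H K → IsStarFactor G H → IsStarFactor G K → weight w H ≡ weight w K)

-- Under the hypothesis G has at most one star-factor, so every weighting
-- (e.g. the constant one) is a witness. An edge at a leaf lies in every
-- star-factor, since the leaf's component must use its only edge. An edge
-- i – j between two non-leaves cannot lie in a star-factor: both are stems,
-- so together with their forced leaf edges u – i and j – u' it would give a
-- path u – i – j – u' of length three inside one star.
module Submission where

open import Defs hiding (sym)
open import Data.Nat using (ℕ; zero; suc; _+_; _<ᵇ_; s≤s; z≤n)
open import Data.Nat.Properties using (suc-injective; 1+n≢0; _≟_)
open import Data.Fin using (Fin; toℕ)
import Data.Fin as F
open import Data.Fin.Properties using () renaming (_≟_ to _≟ᶠ_)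
open import Data.Bool using (Bool; true; false; if_then_else_; _∧_)
open import Data.Empty using (⊥; ⊥-elim)
open import Data.Product using (_,_)
open import Data.Sum using (_⊎_; inj₁; inj₂)
open import Relation.Nullary using (¬_; yes; no)
open import Relation.Binary.PropositionalEquality
  using (_≡_; _≢_; refl; sym; trans; subst; cong; cong₂)

sumFin-cong : ∀ n {f g : Fin n → ℕ} → (∀ i → f i ≡ g i) → sumFin n f ≡ sumFin n g
sumFin-cong zero    f≗g = refl
sumFin-cong (suc n) f≗g = cong₂ _+_ (f≗g F.zero) (sumFin-cong n (λ i → f≗g (F.suc i)))

weight-cong : ∀ {n} (w : Fin n → Fin n → ℕ) {H K : Fin n → Fin n → Bool} →
              (∀ i j → H i j ≡ K i j) → weight w H ≡ weight w K
weight-cong {n} w H≗K = sumFin-cong n λ i → sumFin-cong n λ j →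
  cong (λ b → if (toℕ i <ᵇ toℕ j) ∧ b then w i j else 0) (H≗K i j)

false≢true : false ≢ true
false≢true ()

count : ∀ {n} → (Fin n → Bool) → ℕ
count {n} b = sumFin n (λ j → if b j then 1 else 0)

count≡0⇒false : ∀ {n} (b : Fin n → Bool) → count b ≡ 0 → ∀ {x} → b x ≢ true
count≡0⇒false {suc n} b c≡0 {x} bx with b F.zero in b₀ | x
... | true  | _       = 1+n≢0 c≡0
... | false | F.zero  = ⊥-elim (false≢true (trans (sym b₀) bx))
... | false | F.suc _ = count≡0⇒false (λ j → b (F.suc j)) c≡0 bx

count≡1⇒unique : ∀ {n} (b : Fin n → Bool) → count b ≡ 1 →
                 ∀ {x y} → b x ≡ true → b y ≡ true → x ≡ y
count≡1⇒unique {suc n} b c≡1 {x} {y} bx by with b F.zero in b₀ | x | y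
... | _     | F.zero  | F.zero  = refl
... | true  | F.zero  | F.suc _ = ⊥-elim (count≡0⇒false (λ j → b (F.suc j)) (suc-injective c≡1) by)
... | true  | F.suc _ | _       = ⊥-elim (count≡0⇒false (λ j → b (F.suc j)) (suc-injective c≡1) bx)
... | false | F.zero  | _       = ⊥-elim (false≢true (trans (sym b₀) bx))
... | false | F.suc _ | F.zero  = ⊥-elim (false≢true (trans (sym b₀) by))
... | false | F.suc _ | F.suc _ = cong F.suc (count≡1⇒unique (λ j → b (F.suc j)) c≡1 bx by)

star-no-path₃ : ∀ {n} {H : Fin n → Fin n → Bool} {u i j u' : Fin n} →
                ComponentIsStar H i →
                H i u ≡ true → H i j ≡ true → H j u' ≡ true →
                i ≢ j → u ≢ j → u' ≢ i → ⊥
star-no-path₃ (_ , _ , _ , _ , incident) hiu hij hju' i≢j u≢j u'≢i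
  with incident _ _ here hiu | incident _ _ (step here hij) hju' | incident _ _ here hij
... | _        | inj₁ j≡c  | inj₁ i≡c = i≢j (trans i≡c (sym j≡c))
... | _        | inj₂ u'≡c | inj₁ i≡c = u'≢i (trans u'≡c (sym i≡c))
... | inj₁ i≡c | _         | inj₂ j≡c = i≢j (trans i≡c (sym j≡c))
... | inj₂ u≡c | _         | inj₂ j≡c = u≢j (trans u≡c (sym j≡c))

module _ {n : ℕ} (G : Graph n) where

  open SpanningSubgraph

  adj-flip : ∀ {i j} → adj G i j ≡ true → adj G j i ≡ true
  adj-flip {i} {j} aij = trans (Graph.sym G j i) aij

  adj⇒≢ : ∀ {i j} → adj G i j ≡ true → i ≢ j
  adj⇒≢ {i} aij refl = false≢true (trans (sym (Graph.irrefl G i)) aij)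

  starFactor-flip : ∀ {H i j} → IsStarFactor G H → H i j ≡ true → H j i ≡ true
  starFactor-flip {i = i} {j} (span , _) hij = trans (symH span j i) hij

  leaf-neighbour-unique : ∀ {i x y} → IsLeaf G i →
                          adj G i x ≡ true → adj G i y ≡ true → x ≡ y
  leaf-neighbour-unique {i} leaf = count≡1⇒unique (adj G i) leaf

  leaf-edge∈starFactor : ∀ {H i j} → IsStarFactor G H → IsLeaf G i →
                         adj G i j ≡ true → H i j ≡ true
  leaf-edge∈starFactor {H} {i} sf@(span , stars) leaf aij with stars i
  ... | c , _ , (x , hcx) , spokes , _ with c ≟ᶠ i
  ... | yes refl = subst (λ z → H i z ≡ true)
                     (leaf-neighbour-unique leaf (sub span i x hcx) aij) hcx
  ... | no c≢i   = subst (λ z → H i z ≡ true)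
                     (leaf-neighbour-unique leaf (sub span i c hic) aij) hic
    where hic : H i c ≡ true
          hic = starFactor-flip sf (spokes i here (λ i≡c → c≢i (sym i≡c)))

  edge-to-leaf∈starFactor : ∀ {H v w} → IsStarFactor G H →
                            adj G v w ≡ true → IsLeaf G w → H v w ≡ true
  edge-to-leaf∈starFactor sf avw leaf =
    starFactor-flip sf (leaf-edge∈starFactor sf leaf (adj-flip avw))

  module _ (leaf-or-stem : ∀ v → IsLeaf G v ⊎ IsStem G v) where

    ¬leaf⇒stem : ∀ {v} → ¬ IsLeaf G v → IsStem G v
    ¬leaf⇒stem {v} ¬leaf with leaf-or-stem v
    ... | inj₁ leaf = ⊥-elim (¬leaf leaf)
    ... | inj₂ stem = stem

    starFactor-edge-at-leaf : ∀ {H i j} → IsStarFactor G H → H i j ≡ true →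
                              IsLeaf G i ⊎ IsLeaf G j
    starFactor-edge-at-leaf {i = i} {j} sf@(span , stars) hij
      with degree G i ≟ 1 | degree G j ≟ 1
    ... | yes leafᵢ  | _         = inj₁ leafᵢ
    ... | no  _      | yes leafⱼ = inj₂ leafⱼ
    ... | no  ¬leafᵢ | no ¬leafⱼ with ¬leaf⇒stem ¬leafᵢ | ¬leaf⇒stem ¬leafⱼ
    ...   | u , aiu , leafᵤ | u' , aju' , leafᵤ' =
      ⊥-elim (star-no-path₃ (stars i) (edge-to-leaf∈starFactor sf aiu leafᵤ) hij
                (edge-to-leaf∈starFactor sf aju' leafᵤ')
                (adj⇒≢ (sub span i j hij))
                (λ u≡j → ¬leafⱼ (subst (IsLeaf G) u≡j leafᵤ))
                (λ u'≡i → ¬leafᵢ (subst (IsLeaf G) u'≡i leafᵤ')))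

    starFactor-⊆ : ∀ {H K} → IsStarFactor G H → IsStarFactor G K →
                   ∀ {i j} → H i j ≡ true → K i j ≡ true
    starFactor-⊆ sfH@(spanH , _) sfK {i} {j} hij with starFactor-edge-at-leaf sfH hij
    ... | inj₁ leafᵢ = leaf-edge∈starFactor sfK leafᵢ (sub spanH i j hij)
    ... | inj₂ leafⱼ = starFactor-flip sfK
                         (leaf-edge∈starFactor sfK leafⱼ (sub spanH j i (starFactor-flip sfH hij)))

    starFactor-unique : ∀ {H K} → IsStarFactor G H → IsStarFactor G K →
                        ∀ i j → H i j ≡ K i j
    starFactor-unique {H} {K} sfH sfK i j with H i j in hij | K i j in kij
    ... | true  | true  = refl
    ... | false | false = refl
    ... | true  | false = trans (sym (starFactor-⊆ sfH sfK hij)) kij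
    ... | false | true  = trans (sym hij) (starFactor-⊆ sfK sfH kij)

lemma2p7 : (n : ℕ) (G : Graph n) →
           (∀ (v : Fin n) → IsLeaf G v ⊎ IsStem G v) →
           InΩ G
lemma2p7 n G leaf-or-stem =
  (λ _ _ → 1) , (λ _ _ _ → s≤s z≤n) ,
  λ H K sfH sfK → weight-cong (λ _ _ → 1) (starFactor-unique G leaf-or-stem sfH sfK)
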